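{- Let $G$ be the $m\times n$ triangle lattice tube graph with $n\ge 4$ and $m\ge 3$. Then $T_1(G)=2$.
   Context: The $m\times n$ triangle lattice tube graph is obtained from the $m\times n$ triangular lattice (vertices $(i,j)$, $1\le i\le n$, $1\le j\le m$, with edges $(i,j)(i+1,j)$, $(i,j)(i,j+1)$ and diagonals $(i,j)(i+1,j+1)$) by identifying the first and last vertex of each row, i.e. $(1,j)$ with $(n,j)$, together with the corresponding boundary edges; equivalently it has vertex set $\mathbb Z_{n-1}\times\{1,\dots,m\}$ and edges $(i,j)(i+1,j)$, $(i,j)(i,j+1)$, $(i,j)(i+1,j+1)$ with first coordinates mod $n-1$. Graphs are finite and may have loops and multiple edges; each edge $e$ with endpoints $u,v$ has half-edges $(u,e),(v,e)$. Fix a finite alphabet $\Sigma$ and disjoint copy $\hat\Sigma=\{\hat a:a\in\Sigma\}$; elements of $\Sigma\cup\hat\Sigma$ are cohesive-end types, $\hat{\hat a}=a$. A tile is a finite multiset of cohesive-end types. A pot is a finite set $P$ of tiles such that whenever $x$ occurs in a tile of $P$, $\hat x$ occurs in some tile of $P$; $\#P$ is its number of tiles. An assembly design of a graph $G$ labels half-edges by cohesive-end types so that the two half-edges of each edge receive $a$ and $\hat a$ for some $a\in\Sigma$; $\lambda(v)$ is the multiset of labels at $v$ and $P_\lambda(G)=\{\lambda(v)\}$. $P$ realizes $G$ if $P_\lambda(G)\subseteq P$ for some assembly design $\lambda$. $T_1(G)$ is the minimum of $\#P$ over all pots $P$ that realize $G$. -}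

module Defs where

open import Data.Nat using (ℕ; zero; suc; _+_; _≤_; _<_; _∸_)
open import Data.Nat.DivMod using (_%_; m%n<n)
import Data.Nat as ℕ
open import Data.Fin using (Fin; toℕ; fromℕ<)
import Data.Fin as F
open import Data.Bool using (Bool; true; false; not; if_then_else_)
open import Data.Product using (Σ; ∃; ∃-syntax; _×_; _,_; proj₁; proj₂)
open import Data.List using (List; []; _∷_; length; concatMap; map; allFin; _++_)
open import Data.Nat.ListAction using (sum)
open import Data.List.Relation.Unary.Any using (Any)
open import Data.List.Relation.Unary.All using (All)
open import Data.List.Relation.Unary.AllPairs using (AllPairs)
open import Relation.Binary.PropositionalEquality using (_≡_)
open import Relation.Nullary using (¬_; Dec; yes; no)
open import Relation.Nullary.Decidable using (⌊_⌋)
open import Relation.Binary using (DecidableEquality)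

-- An edge is a pair of endpoints; the edge list may contain repeated
-- entries (multiple edges) and pairs (v , v) (loops).  Edge number k has
-- half-edges (proj₁ e_k , k) ("first half") and (proj₂ e_k , k) ("second half").

record Graph : Set₁ where
  field
    Vtx    : Set
    _≟V_   : DecidableEquality Vtx
    edges  : List (Vtx × Vtx)
open Graph public

Edge : Graph → Set
Edge G = Fin (length (edges G))

endpoints : (G : Graph) → Edge G → Vtx G × Vtx G
endpoints G k = Data.List.lookup (edges G) k

-- Cohesive-end types over the alphabet Σ = Fin s:
-- (a , true) stands for a, (a , false) stands for â.

CE : ℕ → Set
CE s = Fin s × Bool

hat : ∀ {s} → CE s → CE s
hat (a , b) = (a , not b)

_≟CE_ : ∀ {s} → DecidableEquality (CE s)
(a , b) ≟CE (a' , b') with a F.≟ a' | b Data.Bool.≟ b'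
... | yes Relation.Binary.PropositionalEquality.refl | yes Relation.Binary.PropositionalEquality.refl = yes Relation.Binary.PropositionalEquality.refl
... | no p  | _     = no λ { Relation.Binary.PropositionalEquality.refl → p Relation.Binary.PropositionalEquality.refl }
... | yes _ | no q  = no λ { Relation.Binary.PropositionalEquality.refl → q Relation.Binary.PropositionalEquality.refl }

-- A tile is a finite multiset of cohesive-end types, given by its
-- multiplicity function; two tiles are equal iff multiplicities agree.
Tile : ℕ → Set
Tile s = CE s → ℕ

_≈T_ : ∀ {s} → Tile s → Tile s → Set
t ≈T t' = ∀ x → t x ≡ t' x

record IsPot {s : ℕ} (P : List (Tile s)) : Set where
  field
    distinct : AllPairs (λ t t' → ¬ (t ≈T t')) P
    closed   : All (λ t → ∀ x → 0 < t x → Any (λ t' → 0 < t' (hat x)) P) P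

#_ : ∀ {s} → List (Tile s) → ℕ
# P = length P

-- A design assigns to each edge the cohesive-end type
-- of its first half-edge; the second half-edge gets the complementary type.
-- (Every labelling with a / â on the two halves is of this form.)

Design : ℕ → Graph → Set
Design s G = Edge G → CE s

tileAt : ∀ {s} (G : Graph) → Design s G → Vtx G → Tile s
tileAt {s} G d v x = sum (map contrib (allFin (length (edges G))))
  where
    ind : Bool → ℕ
    ind true  = 1
    ind false = 0
    contrib : Edge G → ℕ
    contrib k =
      ind (⌊ (_≟V_ G) (proj₁ (endpoints G k)) v ⌋ Data.Bool.∧ ⌊ d k ≟CE x ⌋)
      + ind (⌊ (_≟V_ G) (proj₂ (endpoints G k)) v ⌋ Data.Bool.∧ ⌊ hat (d k) ≟CE x ⌋)

Realizes : ∀ {s} → List (Tile s) → Graph → Set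
Realizes {s} P G = ∃[ d ] (∀ (v : Vtx G) → Any (λ t → tileAt G d v ≈T t) P)

-- T₁(G) = k : k is the minimum of #P over all pots P (over all finite
-- alphabets, w.l.o.g. Σ = Fin s) realizing G.
T₁≡ : Graph → ℕ → Set
T₁≡ G k =
  (∃[ s ] Σ (List (Tile s)) λ P → IsPot P × Realizes P G × # P ≡ k)
  × (∀ (s : ℕ) (P : List (Tile s)) → IsPot P → Realizes P G → k ≤ # P)

-- The m × n triangle lattice tube graph: vertices ℤ_{n-1} × {1..m}
-- (encoded as Fin (n ∸ 1) × Fin m, rows 0..m-1), edges
-- (i,j)(i+1,j), (i,j)(i,j+1), (i,j)(i+1,j+1), first coordinate mod n-1.

csuc : ∀ {k} → Fin k → Fin k
csuc {suc p} i = fromℕ< (m%n<n (suc (toℕ i)) (suc p))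

TubeV : ℕ → ℕ → Set
TubeV m n = Fin (n ∸ 1) × Fin m

_≟TV_ : ∀ {m n} → DecidableEquality (TubeV m n)
(i , j) ≟TV (i' , j') with i F.≟ i' | j F.≟ j'
... | yes Relation.Binary.PropositionalEquality.refl | yes Relation.Binary.PropositionalEquality.refl = yes Relation.Binary.PropositionalEquality.refl
... | no p  | _     = no λ { Relation.Binary.PropositionalEquality.refl → p Relation.Binary.PropositionalEquality.refl }
... | yes _ | no q  = no λ { Relation.Binary.PropositionalEquality.refl → q Relation.Binary.PropositionalEquality.refl }

tubeEdges : (m n : ℕ) → List (TubeV m n × TubeV m n)
tubeEdges m n =
  concatMap (λ i → concatMap (λ j →
      ((i , j) , (csuc i , j))
      ∷ concatMap (λ j' →
          if ⌊ toℕ j' ℕ.≟ suc (toℕ j) ⌋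
          then ((i , j) , (i , j')) ∷ ((i , j) , (csuc i , j')) ∷ []
          else [])
        (allFin m))
    (allFin m))
  (allFin (n ∸ 1))

TriTube : (m n : ℕ) → Graph
TriTube m n = record
  { Vtx = TubeV m n ; _≟V_ = _≟TV_ {m} {n} ; edges = tubeEdges m n }

{-# OPTIONS --safe #-}
module Submission where

-- Lower bound: summing the tile of a vertex over all cohesive-end types counts
-- every half-edge at the vertex once, so the size of the tile is the degree of
-- the vertex.  For m ≥ 3 the first row of the tube has degree 4 and the second
-- row degree 6, hence a realizing pot has at least two tiles.
--
-- Upper bound: with a single letter a, every vertex is the tail and the head of
-- one horizontal edge, and the tail (head) of one vertical and one diagonal edge
-- exactly when there is a row above (below) it.  Labelling horizontal and
-- vertical edges a at the tail and diagonal edges a at the head, each vertex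
-- gets a and â equally often, namely 1 + [row above] + [row below] ∈ {2, 3}
-- times, so the pot {a²â², a³â³} realizes the tube.

open import Defs
open import Data.Nat using (ℕ; zero; suc; _+_; _*_; _∸_; _≤_; _<_; s≤s; s≤s⁻¹; z≤n)
import Data.Nat as ℕ
open import Data.Nat.Properties
  using ( +-identityʳ; +-assoc; +-comm; *-identityʳ; *-identityˡ; *-zeroʳ; *-assoc; *-distribˡ-+
        ; +-*-semiring; suc-injective; n<1+n; <-trans; 1+n≢n)
open import Data.Nat.DivMod using (_%_; m<n⇒m%n≡m; n%n≡0)
open import Data.Nat.ListAction using (sum)
open import Data.Nat.ListAction.Properties using (sum-++)
open import Data.Nat.Tactic.RingSolver using (solve-∀)
open import Data.Fin using (Fin; toℕ; fromℕ; inject₁)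
import Data.Fin as F
import Data.Fin.Properties as F
open import Data.Fin.Properties using (toℕ-fromℕ<; toℕ-fromℕ; toℕ-inject₁; toℕ<n; toℕ-injective)
open import Data.Fin.Relation.Unary.Top using (view; ‵fromℕ; ‵inject₁)
open import Data.Bool using (Bool; true; false; _∧_; _∨_; if_then_else_)
import Data.Bool as Bool
open import Data.Product using (_×_; _,_; proj₁; proj₂)
open import Data.Sum using (_⊎_; inj₁; inj₂)
open import Data.List using (List; []; _∷_; _++_; length; map; concatMap; allFin; tabulate; lookup)
open import Data.List.Properties using (map-++; tabulate-lookup)
open import Data.List.Relation.Unary.Any using (Any; here; there)
open import Data.List.Relation.Unary.All using ([]; _∷_)
open import Data.List.Relation.Unary.AllPairs using ([]; _∷_)
open import Algebra.Properties.Semiring.Sum +-*-semiring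
  using ( sum-syntax; sum-cong-≗; sum-replicate-zero; sum-init-last; ∑-distrib-+; ∑-comm
        ; *-distribˡ-sum; *-distribʳ-sum)
open import Function using (id; _∘_; case_of_)
open import Relation.Binary.PropositionalEquality
open import Relation.Nullary using (¬_; Dec; yes; no; does; contradiction)
open import Relation.Nullary.Decidable using (⌊_⌋; dec-true; dec-false)

open ≡-Reasoning

-- Iverson brackets and finite sums

𝟙ᵇ : Bool → ℕ
𝟙ᵇ true  = 1
𝟙ᵇ false = 0

𝟙 : ∀ {a} {A : Set a} → Dec A → ℕ
𝟙 a? = 𝟙ᵇ ⌊ a? ⌋

module _ {a} {A : Set a} where

  𝟙-yes : (a? : Dec A) → A → 𝟙 a? ≡ 1
  𝟙-yes (yes _) _  = refl
  𝟙-yes (no ¬a) a = contradiction a ¬a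

  𝟙-no : (a? : Dec A) → ¬ A → 𝟙 a? ≡ 0
  𝟙-no (no _)  _  = refl
  𝟙-no (yes a) ¬a = contradiction a ¬a

  𝟙-*-cong : ∀ (a? : Dec A) {x y} → (A → x ≡ y) → 𝟙 a? * x ≡ 𝟙 a? * y
  𝟙-*-cong (yes a) x≡y = cong (1 *_) (x≡y a)
  𝟙-*-cong (no _)  _   = refl

𝟙-cong : ∀ {a b} {A : Set a} {B : Set b} → (A → B) → (B → A) →
  (a? : Dec A) (b? : Dec B) → 𝟙 a? ≡ 𝟙 b?
𝟙-cong A→B B→A (yes a) b? = sym (𝟙-yes b? (A→B a))
𝟙-cong A→B B→A (no ¬a) b? = sym (𝟙-no b? (¬a ∘ B→A))

𝟙ᵇ-∧ : ∀ b c → 𝟙ᵇ (b ∧ c) ≡ 𝟙ᵇ b * 𝟙ᵇ c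
𝟙ᵇ-∧ true  c = sym (+-identityʳ (𝟙ᵇ c))
𝟙ᵇ-∧ false c = refl

∑-δ : ∀ {k} (i₀ : Fin k) (f : Fin k → ℕ) → ∑[ i < k ] (𝟙 (i F.≟ i₀) * f i) ≡ f i₀
∑-δ {suc k} F.zero f = begin
  f F.zero + 0 + ∑[ i < k ] 0 ≡⟨ cong (f F.zero + 0 +_) (sum-replicate-zero k) ⟩
  f F.zero + 0 + 0            ≡⟨ cong (_+ 0) (+-identityʳ _) ⟩
  f F.zero + 0                ≡⟨ +-identityʳ _ ⟩
  f F.zero                    ∎
∑-δ {suc k} (F.suc i₀) f = begin
  ∑[ i < k ] (𝟙 (F.suc i F.≟ F.suc i₀) * f (F.suc i))
    ≡⟨ sum-cong-≗ {k} (λ i → cong (_* f (F.suc i))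
         (𝟙-cong F.suc-injective (cong F.suc) (F.suc i F.≟ F.suc i₀) (i F.≟ i₀))) ⟩
  ∑[ i < k ] (𝟙 (i F.≟ i₀) * f (F.suc i))
    ≡⟨ ∑-δ i₀ (f ∘ F.suc) ⟩
  f (F.suc i₀) ∎

∑-pull₂ : ∀ {k} x y (f : Fin k → ℕ) → ∑[ i < k ] (x * (y * f i)) ≡ x * (y * ∑[ i < k ] f i)
∑-pull₂ {k} x y f = trans (sym (*-distribˡ-sum {k} x _)) (cong (x *_) (sym (*-distribˡ-sum {k} y f)))

∑∑-distrib-+ : ∀ {k m} (f g : Fin k → Fin m → ℕ) →
  ∑[ i < k ] ∑[ j < m ] (f i j + g i j) ≡ ∑[ i < k ] ∑[ j < m ] f i j + ∑[ i < k ] ∑[ j < m ] g i j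
∑∑-distrib-+ {k} {m} f g = trans (sum-cong-≗ {k} (λ i → ∑-distrib-+ {m} (f i) (g i))) (∑-distrib-+ {k} _ _)

∑∑∑-distrib-+ : ∀ {k m l} (f g : Fin k → Fin m → Fin l → ℕ) →
  ∑[ i < k ] ∑[ j < m ] ∑[ j' < l ] (f i j j' + g i j j')
    ≡ ∑[ i < k ] ∑[ j < m ] ∑[ j' < l ] f i j j' + ∑[ i < k ] ∑[ j < m ] ∑[ j' < l ] g i j j'
∑∑∑-distrib-+ {k} f g = trans (sum-cong-≗ {k} (λ i → ∑∑-distrib-+ (f i) (g i))) (∑-distrib-+ {k} _ _)

SumInvariant : ∀ {k} → (Fin k → Fin k) → Set
SumInvariant {k} σ = ∀ (f : Fin k → ℕ) → ∑[ i < k ] f (σ i) ≡ ∑[ i < k ] f i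

∑∑-δ : ∀ {k m} (σ : Fin k → Fin k) → SumInvariant σ → (i₀ : Fin k) (j₀ : Fin m) (f : Fin m → ℕ) →
  ∑[ i < k ] ∑[ j < m ] (𝟙 (σ i F.≟ i₀) * (𝟙 (j F.≟ j₀) * f j)) ≡ f j₀
∑∑-δ {k} {m} σ σ-inv i₀ j₀ f = begin
  ∑[ i < k ] ∑[ j < m ] (𝟙 (σ i F.≟ i₀) * (𝟙 (j F.≟ j₀) * f j))
    ≡⟨ sum-cong-≗ {k} (λ i → sym (*-distribˡ-sum {m} (𝟙 (σ i F.≟ i₀)) _)) ⟩
  ∑[ i < k ] (𝟙 (σ i F.≟ i₀) * ∑[ j < m ] (𝟙 (j F.≟ j₀) * f j))
    ≡⟨ sum-cong-≗ {k} (λ i → cong (𝟙 (σ i F.≟ i₀) *_) (∑-δ j₀ f)) ⟩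
  ∑[ i < k ] (𝟙 (σ i F.≟ i₀) * f j₀)
    ≡⟨ σ-inv (λ i → 𝟙 (i F.≟ i₀) * f j₀) ⟩
  ∑[ i < k ] (𝟙 (i F.≟ i₀) * f j₀)
    ≡⟨ ∑-δ i₀ (λ _ → f j₀) ⟩
  f j₀ ∎

∑-toℕ≡ : ∀ m c → ∑[ j < m ] 𝟙 (toℕ j ℕ.≟ c) ≡ 𝟙 (c ℕ.<? m)
∑-toℕ≡ zero    c       = refl
∑-toℕ≡ (suc m) zero    = cong suc (sum-replicate-zero m)
∑-toℕ≡ (suc m) (suc c) = begin
  ∑[ j < m ] 𝟙 (suc (toℕ j) ℕ.≟ suc c)
    ≡⟨ sum-cong-≗ {m} (λ j →
         𝟙-cong suc-injective (cong suc) (suc (toℕ j) ℕ.≟ suc c) (toℕ j ℕ.≟ c)) ⟩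
  ∑[ j < m ] 𝟙 (toℕ j ℕ.≟ c)
    ≡⟨ ∑-toℕ≡ m c ⟩
  𝟙 (c ℕ.<? m)
    ≡⟨ 𝟙-cong s≤s s≤s⁻¹ (c ℕ.<? m) (suc c ℕ.<? suc m) ⟩
  𝟙 (suc c ℕ.<? suc m) ∎

∑-suc-toℕ≡ : ∀ m c → c < m → ∑[ j < m ] 𝟙 (c ℕ.≟ suc (toℕ j)) ≡ 𝟙 (1 ℕ.≤? c)
∑-suc-toℕ≡ m zero    _   = sum-replicate-zero m
∑-suc-toℕ≡ m (suc c) c<m = begin
  ∑[ j < m ] 𝟙 (suc c ℕ.≟ suc (toℕ j))
    ≡⟨ sum-cong-≗ {m} (λ j →
         𝟙-cong (sym ∘ suc-injective) (cong suc ∘ sym) (suc c ℕ.≟ suc (toℕ j)) (toℕ j ℕ.≟ c)) ⟩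
  ∑[ j < m ] 𝟙 (toℕ j ℕ.≟ c)
    ≡⟨ ∑-toℕ≡ m c ⟩
  𝟙 (c ℕ.<? m)
    ≡⟨ 𝟙-yes (c ℕ.<? m) (<-trans (n<1+n c) c<m) ⟩
  1 ∎

sum-map-tabulate : ∀ {A : Set} {k} (f : A → ℕ) (g : Fin k → A) → sum (map f (tabulate g)) ≡ ∑[ i < k ] f (g i)
sum-map-tabulate {k = zero}  f g = refl
sum-map-tabulate {k = suc k} f g = cong (f (g F.zero) +_) (sum-map-tabulate f (g ∘ F.suc))

sum-map-allFin : ∀ {k} (f : Fin k → ℕ) → sum (map f (allFin k)) ≡ ∑[ i < k ] f i
sum-map-allFin f = sum-map-tabulate f id

∑-lookup : ∀ {A : Set} (xs : List A) (f : A → ℕ) → ∑[ k < length xs ] f (lookup xs k) ≡ sum (map f xs)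
∑-lookup xs f = trans (sym (sum-map-tabulate f (lookup xs))) (cong (sum ∘ map f) (tabulate-lookup xs))

sum-map-concatMap-allFin : ∀ {A : Set} {k} (f : A → ℕ) (g : Fin k → List A) →
  sum (map f (concatMap g (allFin k))) ≡ ∑[ i < k ] sum (map f (g i))
sum-map-concatMap-allFin f g = trans (go (allFin _)) (sum-map-allFin (λ i → sum (map f (g i))))
  where
  go : ∀ is → sum (map f (concatMap g is)) ≡ sum (map (λ i → sum (map f (g i))) is)
  go []       = refl
  go (i ∷ is) = begin
    sum (map f (g i ++ concatMap g is))              ≡⟨ cong sum (map-++ f (g i) _) ⟩
    sum (map f (g i) ++ map f (concatMap g is))      ≡⟨ sum-++ (map f (g i)) _ ⟩
    sum (map f (g i)) + sum (map f (concatMap g is)) ≡⟨ cong (sum (map f (g i)) +_) (go is) ⟩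
    sum (map f (g i)) + sum (map (λ i → sum (map f (g i))) is) ∎

sum-map-if : ∀ {A : Set} (f : A → ℕ) b (x y : A) →
  sum (map f (if b then x ∷ y ∷ [] else [])) ≡ 𝟙ᵇ b * (f x + f y)
sum-map-if f true  x y = sym (+-assoc (f x) (f y) 0)
sum-map-if f false x y = refl

-- Tiles and degrees

incidence : (G : Graph) → Vtx G → ℕ → ℕ → Vtx G × Vtx G → ℕ
incidence G v p q (u , w) = 𝟙 (_≟V_ G u v) * p + 𝟙 (_≟V_ G w v) * q

halfEdgesAt : (G : Graph) → Vtx G → Vtx G × Vtx G → ℕ
halfEdgesAt G v (u , w) = 𝟙 (_≟V_ G u v) + 𝟙 (_≟V_ G w v)

halfEdgesAt-incidence : ∀ (G : Graph) v e → halfEdgesAt G v e ≡ incidence G v 1 1 e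
halfEdgesAt-incidence G v (u , w) =
  sym (cong₂ _+_ (*-identityʳ (𝟙 (_≟V_ G u v))) (*-identityʳ (𝟙 (_≟V_ G w v))))

degree : (G : Graph) → Vtx G → ℕ
degree G v = sum (map (halfEdgesAt G v) (edges G))

labelCount : ∀ {s} (G : Graph) → Vtx G → CE s → Vtx G × Vtx G → CE s → ℕ
labelCount G v x (u , w) y =
  𝟙ᵇ (⌊ _≟V_ G u v ⌋ ∧ ⌊ y ≟CE x ⌋) + 𝟙ᵇ (⌊ _≟V_ G w v ⌋ ∧ ⌊ hat y ≟CE x ⌋)

labelCount-incidence : ∀ {s} (G : Graph) v (x : CE s) e y →
  labelCount G v x e y ≡ incidence G v (𝟙 (y ≟CE x)) (𝟙 (hat y ≟CE x)) e
labelCount-incidence G v x (u , w) y =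
  cong₂ _+_ (𝟙ᵇ-∧ ⌊ _≟V_ G u v ⌋ ⌊ y ≟CE x ⌋) (𝟙ᵇ-∧ ⌊ _≟V_ G w v ⌋ ⌊ hat y ≟CE x ⌋)

mutual
  tileAt-∑ : ∀ {s} (G : Graph) (d : Design s G) v x →
    tileAt G d v x ≡ ∑[ k < length (edges G) ] labelCount G v x (endpoints G k) (d k)
  tileAt-∑ G d v x =
    trans (sum-map-allFin {length (edges G)} _) (sum-cong-≗ {length (edges G)} (tileAt-summand G d v x))

  -- The left-hand side is the summand in the definition of tileAt; its local
  -- indicator function cannot be named here, so unification fixes it from the use above.
  tileAt-summand : ∀ {s} (G : Graph) (d : Design s G) v x (k : Edge G) →
    _ ≡ labelCount G v x (endpoints G k) (d k)
  tileAt-summand G d v x k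
    with ⌊ _≟V_ G (proj₁ (endpoints G k)) v ⌋ ∧ ⌊ d k ≟CE x ⌋
       | ⌊ _≟V_ G (proj₂ (endpoints G k)) v ⌋ ∧ ⌊ hat (d k) ≟CE x ⌋
  ... | true  | true  = refl
  ... | true  | false = refl
  ... | false | true  = refl
  ... | false | false = refl

size : ∀ {s} → Tile s → ℕ
size {s} t = ∑[ a < s ] (t (a , true) + t (a , false))

size-cong : ∀ {s} {t t' : Tile s} → t ≈T t' → size t ≡ size t'
size-cong {s} t≈t' = sum-cong-≗ {s} (λ a → cong₂ _+_ (t≈t' _) (t≈t' _))

𝟙-≟CE : ∀ {s} (a₀ a : Fin s) (b₀ b : Bool) →
  𝟙 ((a₀ , b₀) ≟CE (a , b)) ≡ 𝟙 (a F.≟ a₀) * 𝟙 (b₀ Bool.≟ b)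
𝟙-≟CE a₀ a b₀ b with a₀ F.≟ a | b₀ Bool.≟ b
... | yes refl | yes refl = sym (trans (*-identityʳ _) (𝟙-yes (a₀ F.≟ a₀) refl))
... | yes refl | no _     = sym (*-zeroʳ (𝟙 (a₀ F.≟ a₀)))
... | no a₀≢a  | yes _    = cong (_* 1) (sym (𝟙-no (a F.≟ a₀) (a₀≢a ∘ sym)))
... | no a₀≢a  | no _     = sym (*-zeroʳ (𝟙 (a F.≟ a₀)))

∑-≟CE : ∀ {s} (y : CE s) → ∑[ a < s ] (𝟙 (y ≟CE (a , true)) + 𝟙 (y ≟CE (a , false))) ≡ 1
∑-≟CE {s} (a₀ , b₀) = begin
  ∑[ a < s ] (𝟙 ((a₀ , b₀) ≟CE (a , true)) + 𝟙 ((a₀ , b₀) ≟CE (a , false)))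
    ≡⟨ sum-cong-≗ {s} (λ a → trans (cong₂ _+_ (𝟙-≟CE a₀ a b₀ true) (𝟙-≟CE a₀ a b₀ false))
                                   (sym (*-distribˡ-+ (𝟙 (a F.≟ a₀)) _ _))) ⟩
  ∑[ a < s ] (𝟙 (a F.≟ a₀) * (𝟙 (b₀ Bool.≟ true) + 𝟙 (b₀ Bool.≟ false)))
    ≡⟨ ∑-δ a₀ _ ⟩
  𝟙 (b₀ Bool.≟ true) + 𝟙 (b₀ Bool.≟ false)
    ≡⟨ one-of b₀ ⟩
  1 ∎
  where
  one-of : ∀ b → 𝟙 (b Bool.≟ true) + 𝟙 (b Bool.≟ false) ≡ 1
  one-of true  = refl
  one-of false = refl

∑-labelCount : ∀ {s} (G : Graph) v e (y : CE s) →
  ∑[ a < s ] (labelCount G v (a , true) e y + labelCount G v (a , false) e y) ≡ halfEdgesAt G v e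
∑-labelCount {s} G v (u , w) y = begin
  ∑[ a < s ] (labelCount G v (a , true) (u , w) y + labelCount G v (a , false) (u , w) y)
    ≡⟨ sum-cong-≗ {s} (λ a → trans
         (cong₂ _+_ (labelCount-incidence G v (a , true) (u , w) y) (labelCount-incidence G v (a , false) (u , w) y))
         (regroup tail head (𝟙 (y ≟CE (a , true))) (𝟙 (hat y ≟CE (a , true)))
                            (𝟙 (y ≟CE (a , false))) (𝟙 (hat y ≟CE (a , false))))) ⟩
  ∑[ a < s ] (tail * carries y a + head * carries (hat y) a)
    ≡⟨ ∑-distrib-+ {s} _ _ ⟩
  ∑[ a < s ] (tail * carries y a) + ∑[ a < s ] (head * carries (hat y) a)
    ≡⟨ sym (cong₂ _+_ (*-distribˡ-sum {s} tail _) (*-distribˡ-sum {s} head _)) ⟩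
  tail * ∑[ a < s ] carries y a + head * ∑[ a < s ] carries (hat y) a
    ≡⟨ cong₂ (λ p q → tail * p + head * q) (∑-≟CE y) (∑-≟CE (hat y)) ⟩
  tail * 1 + head * 1
    ≡⟨ cong₂ _+_ (*-identityʳ tail) (*-identityʳ head) ⟩
  halfEdgesAt G v (u , w) ∎
  where
  tail head : ℕ
  tail = 𝟙 (_≟V_ G u v)
  head = 𝟙 (_≟V_ G w v)

  carries : CE s → Fin s → ℕ
  carries y a = 𝟙 (y ≟CE (a , true)) + 𝟙 (y ≟CE (a , false))

  regroup : ∀ p q a b c d → p * a + q * b + (p * c + q * d) ≡ p * (a + c) + q * (b + d)
  regroup = solve-∀

size-tileAt : ∀ {s} (G : Graph) (d : Design s G) v → size (tileAt G d v) ≡ degree G v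
size-tileAt {s} G d v = begin
  ∑[ a < s ] (tileAt G d v (a , true) + tileAt G d v (a , false))
    ≡⟨ sum-cong-≗ {s} (λ a → cong₂ _+_ (tileAt-∑ G d v _) (tileAt-∑ G d v _)) ⟩
  ∑[ a < s ] (∑[ k < ℓ ] count (a , true) k + ∑[ k < ℓ ] count (a , false) k)
    ≡⟨ sum-cong-≗ {s} (λ a → sym (∑-distrib-+ {ℓ} _ _)) ⟩
  ∑[ a < s ] ∑[ k < ℓ ] (count (a , true) k + count (a , false) k)
    ≡⟨ ∑-comm {s} {ℓ} _ ⟩
  ∑[ k < ℓ ] ∑[ a < s ] (count (a , true) k + count (a , false) k)
    ≡⟨ sum-cong-≗ {ℓ} (λ k → ∑-labelCount G v (endpoints G k) (d k)) ⟩
  ∑[ k < ℓ ] halfEdgesAt G v (endpoints G k)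
    ≡⟨ ∑-lookup (edges G) (halfEdgesAt G v) ⟩
  degree G v ∎
  where
  ℓ = length (edges G)
  count : CE s → Edge G → ℕ
  count x k = labelCount G v x (endpoints G k) (d k)

degree≢⇒2≤# : ∀ {s} {G : Graph} {P : List (Tile s)} → Realizes P G → (u w : Vtx G) →
  degree G u ≢ degree G w → 2 ≤ # P
degree≢⇒2≤# {P = []} (_ , realized) u w _ with realized u
... | ()
degree≢⇒2≤# {G = G} {P = t ∷ []} (d , realized) u w u≢w with realized u | realized w
... | here u≈t | here w≈t = contradiction (begin
  degree G u          ≡⟨ sym (size-tileAt G d u) ⟩
  size (tileAt G d u) ≡⟨ size-cong u≈t ⟩
  size t              ≡⟨ sym (size-cong w≈t) ⟩
  size (tileAt G d w) ≡⟨ size-tileAt G d w ⟩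
  degree G w          ∎) u≢w
... | there () | _
... | _        | there ()
degree≢⇒2≤# {P = _ ∷ _ ∷ _} _ _ _ _ = s≤s (s≤s z≤n)

toℕ-csuc : ∀ {p} (i : Fin (suc p)) → toℕ (csuc i) ≡ suc (toℕ i) % suc p
toℕ-csuc i = toℕ-fromℕ< _

csuc-inject₁ : ∀ {p} (i : Fin p) → csuc (inject₁ i) ≡ F.suc i
csuc-inject₁ {p} i = toℕ-injective (begin
  toℕ (csuc (inject₁ i))        ≡⟨ toℕ-csuc (inject₁ i) ⟩
  suc (toℕ (inject₁ i)) % suc p ≡⟨ cong (λ t → suc t % suc p) (toℕ-inject₁ i) ⟩
  suc (toℕ i) % suc p           ≡⟨ m<n⇒m%n≡m (s≤s (toℕ<n i)) ⟩
  suc (toℕ i)                   ∎)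

csuc-fromℕ : ∀ p → csuc (fromℕ p) ≡ F.zero
csuc-fromℕ p = toℕ-injective (begin
  toℕ (csuc (fromℕ p))        ≡⟨ toℕ-csuc (fromℕ p) ⟩
  suc (toℕ (fromℕ p)) % suc p ≡⟨ cong (λ t → suc t % suc p) (toℕ-fromℕ p) ⟩
  suc p % suc p               ≡⟨ n%n≡0 (suc p) ⟩
  0                           ∎)

csuc≢ : ∀ {p} (i : Fin (suc (suc p))) → i ≢ csuc i
csuc≢ i with view i
... | ‵fromℕ     = λ i≡csuc-i → case trans i≡csuc-i (csuc-fromℕ _) of λ ()
... | ‵inject₁ j = λ i≡csuc-i →
  1+n≢n (sym (trans (sym (toℕ-inject₁ j)) (cong toℕ (trans i≡csuc-i (csuc-inject₁ j)))))

∑-rotate : ∀ {k} → SumInvariant (csuc {k})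
∑-rotate {zero}  f = refl
∑-rotate {suc p} f = begin
  ∑[ i < suc p ] f (csuc i)
    ≡⟨ sum-init-last (f ∘ csuc) ⟩
  ∑[ i < p ] f (csuc (inject₁ i)) + f (csuc (fromℕ p))
    ≡⟨ cong₂ _+_ (sum-cong-≗ {p} (cong f ∘ csuc-inject₁)) (cong f (csuc-fromℕ p)) ⟩
  ∑[ i < p ] f (F.suc i) + f F.zero
    ≡⟨ +-comm _ (f F.zero) ⟩
  ∑[ i < suc p ] f i ∎

-- Incidences in the tube

hasAbove : ∀ {m} → Fin m → ℕ
hasAbove {m} j = 𝟙 (suc (toℕ j) ℕ.<? m)

hasBelow : ∀ {m} → Fin m → ℕ
hasBelow j = 𝟙 (1 ℕ.≤? toℕ j)

halfDegree : ∀ {m} → Fin m → ℕ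
halfDegree j = 1 + hasAbove j + hasBelow j

rowStep : ∀ {m} → Fin m → Fin m → ℕ
rowStep j j' = 𝟙 (toℕ j' ℕ.≟ suc (toℕ j))

rowStep≢ : ∀ {m} {j j' : Fin m} → toℕ j' ≡ suc (toℕ j) → j ≢ j'
rowStep≢ j'≡1+j refl = 1+n≢n (sym j'≡1+j)

∑-rowStep-out : ∀ {m} (j : Fin m) → ∑[ j' < m ] rowStep j j' ≡ hasAbove j
∑-rowStep-out {m} j = ∑-toℕ≡ m (suc (toℕ j))

∑-rowStep-in : ∀ {m} (j' : Fin m) → ∑[ j < m ] rowStep j j' ≡ hasBelow j'
∑-rowStep-in {m} j' = ∑-suc-toℕ≡ m (toℕ j') (toℕ<n j')

∑-incidence-sameRow : ∀ {k m} (σ : Fin k → Fin k) → SumInvariant σ → (p q : ℕ) (i₀ : Fin k) (j₀ : Fin m) →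
  ∑[ i < k ] ∑[ j < m ] (𝟙 (i F.≟ i₀) * (𝟙 (j F.≟ j₀) * p) + 𝟙 (σ i F.≟ i₀) * (𝟙 (j F.≟ j₀) * q))
    ≡ p + q
∑-incidence-sameRow {k} {m} σ σ-inv p q i₀ j₀ = trans (∑∑-distrib-+ {k} {m} _ _)
  (cong₂ _+_ (∑∑-δ id (λ _ → refl) i₀ j₀ (λ _ → p)) (∑∑-δ σ σ-inv i₀ j₀ (λ _ → q)))

∑-incidence-rows : ∀ {k m} (σ : Fin k → Fin k) → SumInvariant σ → (R : Fin m → Fin m → ℕ) (p q : ℕ)
  (i₀ : Fin k) (j₀ : Fin m) →
  ∑[ i < k ] ∑[ j < m ] ∑[ j' < m ]
    (R j j' * (𝟙 (i F.≟ i₀) * (𝟙 (j F.≟ j₀) * p) + 𝟙 (σ i F.≟ i₀) * (𝟙 (j' F.≟ j₀) * q)))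
    ≡ (∑[ j' < m ] R j₀ j') * p + (∑[ j < m ] R j j₀) * q
∑-incidence-rows {k} {m} σ σ-inv R p q i₀ j₀ = begin
  ∑[ i < k ] ∑[ j < m ] ∑[ j' < m ] (R j j' * (δ i * (δ' j * p) + δ (σ i) * (δ' j' * q)))
    ≡⟨ sum-cong-≗ {k} (λ i → sum-cong-≗ {m} (λ j → sum-cong-≗ {m} (λ j' →
         spread (R j j') (δ i) (δ' j) p (δ (σ i)) (δ' j') q))) ⟩
  ∑[ i < k ] ∑[ j < m ] ∑[ j' < m ] (δ i * (δ' j * (R j j' * p)) + δ (σ i) * (δ' j' * (R j j' * q)))
    ≡⟨ ∑∑∑-distrib-+ {k} {m} {m} _ _ ⟩
  ∑[ i < k ] ∑[ j < m ] ∑[ j' < m ] (δ i * (δ' j * (R j j' * p)))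
    + ∑[ i < k ] ∑[ j < m ] ∑[ j' < m ] (δ (σ i) * (δ' j' * (R j j' * q)))
    ≡⟨ cong₂ _+_ tails heads ⟩
  (∑[ j' < m ] R j₀ j') * p + (∑[ j < m ] R j j₀) * q ∎
  where
  δ : Fin k → ℕ
  δ i = 𝟙 (i F.≟ i₀)
  δ' : Fin m → ℕ
  δ' j = 𝟙 (j F.≟ j₀)

  spread : ∀ r a b p c d q → r * (a * (b * p) + c * (d * q)) ≡ a * (b * (r * p)) + c * (d * (r * q))
  spread = solve-∀

  tails : ∑[ i < k ] ∑[ j < m ] ∑[ j' < m ] (δ i * (δ' j * (R j j' * p))) ≡ (∑[ j' < m ] R j₀ j') * p
  tails = begin
    ∑[ i < k ] ∑[ j < m ] ∑[ j' < m ] (δ i * (δ' j * (R j j' * p)))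
      ≡⟨ sum-cong-≗ {k} (λ i → sum-cong-≗ {m} (λ j →
           ∑-pull₂ {m} (δ i) (δ' j) (λ j' → R j j' * p))) ⟩
    ∑[ i < k ] ∑[ j < m ] (δ i * (δ' j * ∑[ j' < m ] (R j j' * p)))
      ≡⟨ ∑∑-δ id (λ _ → refl) i₀ j₀ (λ j → ∑[ j' < m ] (R j j' * p)) ⟩
    ∑[ j' < m ] (R j₀ j' * p)
      ≡⟨ sym (*-distribʳ-sum {m} p (R j₀)) ⟩
    (∑[ j' < m ] R j₀ j') * p ∎

  heads : ∑[ i < k ] ∑[ j < m ] ∑[ j' < m ] (δ (σ i) * (δ' j' * (R j j' * q))) ≡ (∑[ j < m ] R j j₀) * q
  heads = begin
    ∑[ i < k ] ∑[ j < m ] ∑[ j' < m ] (δ (σ i) * (δ' j' * (R j j' * q)))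
      ≡⟨ sum-cong-≗ {k} (λ i → ∑-comm {m} {m} _) ⟩
    ∑[ i < k ] ∑[ j' < m ] ∑[ j < m ] (δ (σ i) * (δ' j' * (R j j' * q)))
      ≡⟨ sum-cong-≗ {k} (λ i → sum-cong-≗ {m} (λ j' →
           ∑-pull₂ {m} (δ (σ i)) (δ' j') (λ j → R j j' * q))) ⟩
    ∑[ i < k ] ∑[ j' < m ] (δ (σ i) * (δ' j' * ∑[ j < m ] (R j j' * q)))
      ≡⟨ ∑∑-δ σ σ-inv i₀ j₀ (λ j' → ∑[ j < m ] (R j j' * q)) ⟩
    ∑[ j < m ] (R j j₀ * q)
      ≡⟨ sym (*-distribʳ-sum {m} q (λ j → R j j₀)) ⟩
    (∑[ j < m ] R j j₀) * q ∎

sum-tubeEdges : ∀ m n (g : TubeV m n × TubeV m n → ℕ) →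
  sum (map g (tubeEdges m n))
    ≡ ∑[ i < n ∸ 1 ] ∑[ j < m ] g ((i , j) , (csuc i , j))
      + (∑[ i < n ∸ 1 ] ∑[ j < m ] ∑[ j' < m ] (rowStep j j' * g ((i , j) , (i , j')))
         + ∑[ i < n ∸ 1 ] ∑[ j < m ] ∑[ j' < m ] (rowStep j j' * g ((i , j) , (csuc i , j'))))
sum-tubeEdges m n g = begin
  sum (map g (tubeEdges m n))
    ≡⟨ trans (sum-map-concatMap-allFin {k = n ∸ 1} g _) (sum-cong-≗ {n ∸ 1} λ i →
         trans (sum-map-concatMap-allFin {k = m} g _) (sum-cong-≗ {m} λ j →
           cong (g (hor i j) +_) (sum-upward i j))) ⟩
  ∑[ i < n ∸ 1 ] ∑[ j < m ]
    (g (hor i j) + ∑[ j' < m ] (rowStep j j' * g (ver i j j') + rowStep j j' * g (dia i j j')))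
    ≡⟨ ∑∑-distrib-+ {n ∸ 1} {m} _ _ ⟩
  ∑[ i < n ∸ 1 ] ∑[ j < m ] g (hor i j)
    + ∑[ i < n ∸ 1 ] ∑[ j < m ] ∑[ j' < m ] (rowStep j j' * g (ver i j j') + rowStep j j' * g (dia i j j'))
    ≡⟨ cong (∑[ i < n ∸ 1 ] ∑[ j < m ] g (hor i j) +_) (∑∑∑-distrib-+ {n ∸ 1} {m} {m} _ _) ⟩
  ∑[ i < n ∸ 1 ] ∑[ j < m ] g (hor i j)
    + (∑[ i < n ∸ 1 ] ∑[ j < m ] ∑[ j' < m ] (rowStep j j' * g (ver i j j'))
       + ∑[ i < n ∸ 1 ] ∑[ j < m ] ∑[ j' < m ] (rowStep j j' * g (dia i j j'))) ∎
  where
  TubeEdge = TubeV m n × TubeV m n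
  hor : Fin (n ∸ 1) → Fin m → TubeEdge
  hor i j = (i , j) , (csuc i , j)
  ver dia : Fin (n ∸ 1) → Fin m → Fin m → TubeEdge
  ver i j j' = (i , j) , (i , j')
  dia i j j' = (i , j) , (csuc i , j')

  upwardEdges : Fin (n ∸ 1) → Fin m → List TubeEdge
  upwardEdges i j =
    concatMap (λ j' → if ⌊ toℕ j' ℕ.≟ suc (toℕ j) ⌋ then ver i j j' ∷ dia i j j' ∷ [] else []) (allFin m)

  sum-upward : ∀ i j →
    sum (map g (upwardEdges i j)) ≡ ∑[ j' < m ] (rowStep j j' * g (ver i j j') + rowStep j j' * g (dia i j j'))
  sum-upward i j = trans (sum-map-concatMap-allFin {k = m} g _) (sum-cong-≗ {m} (λ j' →
    trans (sum-map-if g ⌊ toℕ j' ℕ.≟ suc (toℕ j) ⌋ (ver i j j') (dia i j j'))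
          (*-distribˡ-+ (rowStep j j') (g (ver i j j')) (g (dia i j j')))))

𝟙-≟TV : ∀ {m n} (a c : Fin (n ∸ 1)) (b d : Fin m) →
  𝟙 (_≟TV_ {m} {n} (a , b) (c , d)) ≡ 𝟙 (a F.≟ c) * 𝟙 (b F.≟ d)
𝟙-≟TV a c b d with a F.≟ c | b F.≟ d
... | yes refl | yes refl = refl
... | yes refl | no _     = refl
... | no _     | yes _    = refl
... | no _     | no _     = refl

incidence-tube : ∀ {m n} (i₀ : Fin (n ∸ 1)) (j₀ : Fin m) p q a b c d →
  incidence (TriTube m n) (i₀ , j₀) p q ((a , b) , (c , d))
    ≡ 𝟙 (a F.≟ i₀) * (𝟙 (b F.≟ j₀) * p) + 𝟙 (c F.≟ i₀) * (𝟙 (d F.≟ j₀) * q)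
incidence-tube {m} {n} i₀ j₀ p q a b c d = cong₂ _+_
  (trans (cong (_* p) (𝟙-≟TV {m} {n} a i₀ b j₀)) (*-assoc (𝟙 (a F.≟ i₀)) (𝟙 (b F.≟ j₀)) p))
  (trans (cong (_* q) (𝟙-≟TV {m} {n} c i₀ d j₀)) (*-assoc (𝟙 (c F.≟ i₀)) (𝟙 (d F.≟ j₀)) q))

sum-tube-incidence : ∀ {m n} (i₀ : Fin (n ∸ 1)) (j₀ : Fin m) (g : TubeV m n × TubeV m n → ℕ)
  (pH qH pV qV pD qD : ℕ) →
  (∀ i j → g ((i , j) , (csuc i , j)) ≡ incidence (TriTube m n) (i₀ , j₀) pH qH ((i , j) , (csuc i , j))) →
  (∀ i j j' → toℕ j' ≡ suc (toℕ j) →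
     g ((i , j) , (i , j')) ≡ incidence (TriTube m n) (i₀ , j₀) pV qV ((i , j) , (i , j'))) →
  (∀ i j j' → toℕ j' ≡ suc (toℕ j) →
     g ((i , j) , (csuc i , j')) ≡ incidence (TriTube m n) (i₀ , j₀) pD qD ((i , j) , (csuc i , j'))) →
  sum (map g (tubeEdges m n))
    ≡ pH + qH + (hasAbove j₀ * pV + hasBelow j₀ * qV + (hasAbove j₀ * pD + hasBelow j₀ * qD))
sum-tube-incidence {m} {n} i₀ j₀ g pH qH pV qV pD qD horizontal vertical diagonal = begin
  sum (map g (tubeEdges m n))
    ≡⟨ sum-tubeEdges m n g ⟩
  ∑[ i < n ∸ 1 ] ∑[ j < m ] g ((i , j) , (csuc i , j))
    + (∑[ i < n ∸ 1 ] ∑[ j < m ] ∑[ j' < m ] (rowStep j j' * g ((i , j) , (i , j')))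
       + ∑[ i < n ∸ 1 ] ∑[ j < m ] ∑[ j' < m ] (rowStep j j' * g ((i , j) , (csuc i , j'))))
    ≡⟨ cong₂ _+_
         (sum-cong-≗ {n ∸ 1} λ i → sum-cong-≗ {m} λ j →
            trans (horizontal i j) (incidence-tube {m} {n} i₀ j₀ pH qH i j (csuc i) j))
         (cong₂ _+_
           (sum-cong-≗ {n ∸ 1} λ i → sum-cong-≗ {m} λ j → sum-cong-≗ {m} λ j' →
              𝟙-*-cong (toℕ j' ℕ.≟ suc (toℕ j)) λ step →
                trans (vertical i j j' step) (incidence-tube {m} {n} i₀ j₀ pV qV i j i j'))
           (sum-cong-≗ {n ∸ 1} λ i → sum-cong-≗ {m} λ j → sum-cong-≗ {m} λ j' →
              𝟙-*-cong (toℕ j' ℕ.≟ suc (toℕ j)) λ step →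
                trans (diagonal i j j' step) (incidence-tube {m} {n} i₀ j₀ pD qD i j (csuc i) j'))) ⟩
  ∑[ i < n ∸ 1 ] ∑[ j < m ] (δ i * (δ' j * pH) + δ (csuc i) * (δ' j * qH))
    + (∑[ i < n ∸ 1 ] ∑[ j < m ] ∑[ j' < m ] (rowStep j j' * (δ i * (δ' j * pV) + δ i * (δ' j' * qV)))
       + ∑[ i < n ∸ 1 ] ∑[ j < m ] ∑[ j' < m ] (rowStep j j' * (δ i * (δ' j * pD) + δ (csuc i) * (δ' j' * qD))))
    ≡⟨ cong₂ _+_ (∑-incidence-sameRow csuc ∑-rotate pH qH i₀ j₀)
                 (cong₂ _+_ (∑-incidence-rows id (λ _ → refl) rowStep pV qV i₀ j₀)
                            (∑-incidence-rows csuc ∑-rotate rowStep pD qD i₀ j₀)) ⟩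
  pH + qH + (out * pV + in' * qV + (out * pD + in' * qD))
    ≡⟨ cong₂ (λ a b → pH + qH + (a * pV + b * qV + (a * pD + b * qD)))
             (∑-rowStep-out j₀) (∑-rowStep-in j₀) ⟩
  pH + qH + (hasAbove j₀ * pV + hasBelow j₀ * qV + (hasAbove j₀ * pD + hasBelow j₀ * qD)) ∎
  where
  δ : Fin (n ∸ 1) → ℕ
  δ i = 𝟙 (i F.≟ i₀)
  δ' : Fin m → ℕ
  δ' j = 𝟙 (j F.≟ j₀)
  out in' : ℕ
  out = ∑[ j' < m ] rowStep j₀ j'
  in' = ∑[ j < m ] rowStep j j₀

degree-tube : ∀ m n (i : Fin (n ∸ 1)) (j : Fin m) → degree (TriTube m n) (i , j) ≡ 2 * halfDegree j
degree-tube m n i j = begin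
  degree G (i , j)
    ≡⟨ sum-tube-incidence {m} {n} i j (halfEdgesAt G (i , j)) 1 1 1 1 1 1
         (λ i' j' → halfEdgesAt-incidence G (i , j) ((i' , j') , (csuc i' , j')))
         (λ i' j' j'' _ → halfEdgesAt-incidence G (i , j) ((i' , j') , (i' , j'')))
         (λ i' j' j'' _ → halfEdgesAt-incidence G (i , j) ((i' , j') , (csuc i' , j''))) ⟩
  1 + 1 + (hasAbove j * 1 + hasBelow j * 1 + (hasAbove j * 1 + hasBelow j * 1))
    ≡⟨ double (hasAbove j) (hasBelow j) ⟩
  2 * halfDegree j ∎
  where
  G = TriTube m n
  double : ∀ a b → 1 + 1 + (a * 1 + b * 1 + (a * 1 + b * 1)) ≡ 2 * (1 + a + b)
  double = solve-∀

tube-realizes⇒2≤# : ∀ m k {s} {P : List (Tile s)} → Realizes P (TriTube (3 + m) (2 + k)) → 2 ≤ # P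
tube-realizes⇒2≤# m k realizes = degree≢⇒2≤# {G = TriTube (3 + m) (2 + k)} realizes
  (F.zero , F.zero) (F.zero , F.suc F.zero)
  (λ eq → 4≢6 (trans (sym (degree-tube (3 + m) (2 + k) F.zero F.zero))
                     (trans eq (degree-tube (3 + m) (2 + k) F.zero (F.suc F.zero)))))
  where
  4≢6 : 2 * halfDegree {3 + m} F.zero ≢ 2 * halfDegree {3 + m} (F.suc F.zero)
  4≢6 ()

-- A two-tile pot

upwardLabel : ∀ {m n} → TubeV m n × TubeV m n → CE 1
upwardLabel ((i , j) , (i' , j')) = F.zero , does (j F.≟ j') ∨ does (i F.≟ i')

upward : ∀ {m n} → Design 1 (TriTube m n)
upward {m} {n} k = upwardLabel {m} {n} (endpoints (TriTube m n) k)

upwardLabel-horizontal : ∀ {m n} (i : Fin (n ∸ 1)) (j : Fin m) →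
  upwardLabel {m} {n} ((i , j) , (csuc i , j)) ≡ (F.zero , true)
upwardLabel-horizontal i j rewrite dec-true (j F.≟ j) refl = refl

upwardLabel-vertical : ∀ {m n} (i : Fin (n ∸ 1)) (j j' : Fin m) → toℕ j' ≡ suc (toℕ j) →
  upwardLabel {m} {n} ((i , j) , (i , j')) ≡ (F.zero , true)
upwardLabel-vertical i j j' step
  rewrite dec-false (j F.≟ j') (rowStep≢ step) | dec-true (i F.≟ i) refl = refl

upwardLabel-diagonal : ∀ {m k} (i : Fin (suc (suc k))) (j j' : Fin m) → toℕ j' ≡ suc (toℕ j) →
  upwardLabel {m} {3 + k} ((i , j) , (csuc i , j')) ≡ (F.zero , false)
upwardLabel-diagonal i j j' step
  rewrite dec-false (j F.≟ j') (rowStep≢ step) | dec-false (i F.≟ csuc i) (csuc≢ i) = refl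

tileAt-upward : ∀ m k (i : Fin (suc (suc k))) (j : Fin m) (x : CE 1) →
  tileAt (TriTube m (3 + k)) (upward {m} {3 + k}) (i , j) x ≡ halfDegree j
tileAt-upward m k i j x = begin
  tileAt G (upward {m} {3 + k}) (i , j) x
    ≡⟨ tileAt-∑ G (upward {m} {3 + k}) (i , j) x ⟩
  ∑[ e < length (edges G) ] count (endpoints G e)
    ≡⟨ ∑-lookup (edges G) count ⟩
  sum (map count (tubeEdges m (3 + k)))
    ≡⟨ sum-tube-incidence {m} {3 + k} i j count a â a â â a
         (λ i' j' → labelled ((i' , j') , (csuc i' , j')) (upwardLabel-horizontal {m} {3 + k} i' j'))
         (λ i' j' j'' step → labelled ((i' , j') , (i' , j'')) (upwardLabel-vertical {m} {3 + k} i' j' j'' step))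
         (λ i' j' j'' step → labelled ((i' , j') , (csuc i' , j'')) (upwardLabel-diagonal i' j' j'' step)) ⟩
  a + â + (hasAbove j * a + hasBelow j * â + (hasAbove j * â + hasBelow j * a))
    ≡⟨ factor a â (hasAbove j) (hasBelow j) ⟩
  (a + â) * halfDegree j
    ≡⟨ cong (_* halfDegree j) (a+â≡1 x) ⟩
  1 * halfDegree j
    ≡⟨ *-identityˡ (halfDegree j) ⟩
  halfDegree j ∎
  where
  G = TriTube m (3 + k)
  count : TubeV m (3 + k) × TubeV m (3 + k) → ℕ
  count e = labelCount G (i , j) x e (upwardLabel {m} {3 + k} e)
  a â : ℕ
  a = 𝟙 ((F.zero , true) ≟CE x)
  â = 𝟙 ((F.zero , false) ≟CE x)

  labelled : ∀ e {ℓ} → upwardLabel {m} {3 + k} e ≡ ℓ →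
    count e ≡ incidence G (i , j) (𝟙 (ℓ ≟CE x)) (𝟙 (hat ℓ ≟CE x)) e
  labelled e refl = labelCount-incidence G (i , j) x e (upwardLabel {m} {3 + k} e)

  a+â≡1 : ∀ x → 𝟙 ((F.zero , true) ≟CE x) + 𝟙 ((F.zero , false) ≟CE x) ≡ 1
  a+â≡1 (F.zero , true)  = refl
  a+â≡1 (F.zero , false) = refl

  factor : ∀ a â u w → a + â + (u * a + w * â + (u * â + w * a)) ≡ (a + â) * (1 + u + w)
  factor = solve-∀

halfDegree-2⊎3 : ∀ {m} → 2 ≤ m → (j : Fin m) → halfDegree j ≡ 2 ⊎ halfDegree j ≡ 3
halfDegree-2⊎3 {m} 2≤m F.zero rewrite 𝟙-yes (1 ℕ.<? m) 2≤m = inj₁ refl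
halfDegree-2⊎3 {m} 2≤m (F.suc j) with suc (toℕ (F.suc j)) ℕ.<? m
... | yes _ = inj₂ refl
... | no _  = inj₁ refl

uniform : ℕ → Tile 1
uniform c _ = c

pot : List (Tile 1)
pot = uniform 2 ∷ uniform 3 ∷ []

pot-isPot : IsPot pot
pot-isPot = record
  { distinct = ((λ 2≈3 → case 2≈3 (F.zero , true) of λ ()) ∷ []) ∷ [] ∷ []
  ; closed   = (λ _ _ → here (s≤s z≤n)) ∷ (λ _ _ → here (s≤s z≤n)) ∷ []
  }

uniform-∈-pot : ∀ (t : Tile 1) {c} → (∀ x → t x ≡ c) → c ≡ 2 ⊎ c ≡ 3 → Any (t ≈T_) pot
uniform-∈-pot t t≡c (inj₁ refl) = here t≡c
uniform-∈-pot t t≡c (inj₂ refl) = there (here t≡c)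

upward-realizes : ∀ m k → 2 ≤ m → Realizes pot (TriTube m (3 + k))
upward-realizes m k 2≤m = upward {m} {3 + k} , λ where
  (i , j) → uniform-∈-pot _ (tileAt-upward m k i j) (halfDegree-2⊎3 2≤m j)

proposition8 : (m n : ℕ) → 4 ≤ n → 3 ≤ m → T₁≡ (TriTube m n) 2
proposition8 (suc (suc (suc m))) (suc (suc (suc (suc k)))) (s≤s (s≤s (s≤s (s≤s _)))) (s≤s (s≤s (s≤s _))) =
  (1 , pot , pot-isPot , upward-realizes (3 + m) (suc k) (s≤s (s≤s z≤n)) , refl) ,
  λ _ _ _ realizes → tube-realizes⇒2≤# m (suc (suc k)) realizes
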